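{- Let $\mathfrak{B}$ be a temporal structure preserved by $\mathrm{pp}$, let $\mathfrak{A}$ be an instance of $\mathrm{CSP}(\mathfrak{B})$, and let $S$ be a union of free sets of $\mathfrak{A}$. Then $\mathfrak{A}$ has a solution if and only if $\mathrm{pr}_{A\setminus S}(\mathfrak{A})$ has a solution.
   Context: A temporal structure is a relational structure with domain $\mathbb{Q}$ and a finite relational signature $\tau$ whose relations are first-order definable in $(\mathbb{Q};<)$. Standing assumption: the signature is closed under projections, i.e. for every $R\in\tau$ of arity $n$ and every $I\subseteq[n]$ there is a symbol $\mathrm{pr}_I R\in\tau$ interpreted as $\mathrm{pr}_I(R^{\mathfrak{B}})=\{(t[i_1],\dots,t[i_\ell]) : t\in R^{\mathfrak{B}}\}$ where $I=\{i_1<\dots<i_\ell\}$. An instance of $\mathrm{CSP}(\mathfrak{B})$ is a finite $\tau$-structure $\mathfrak{A}$; a solution is a homomorphism $\mathfrak{A}\to\mathfrak{B}$. An operation $f$ preserves $\mathfrak{B}$ if applying it componentwise to tuples of each relation yields a tuple of that relation. $\mathrm{pp}$ is a fixed binary operation on $\mathbb{Q}$ such that $\mathrm{pp}(a,b)\le\mathrm{pp}(a',b')$ iff ($a\le 0$ and $a\le a'$) or ($0<a$, $0<a'$ and $b\le b'$). For $t\in\mathbb{Q}^k$, $\mathrm{Minset}(t)$ is the set of $i\in[k]$ such that $t[i]$ is a minimal entry of $t$. A free set of $\mathfrak{A}$ is a non-empty $F\subseteq A$ such that for every $R\in\tau$ of arity $k$ and every $s\in R^{\mathfrak{A}}$,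 either no entry of $s$ lies in $F$, or there is $t\in R^{\mathfrak{B}}$ with $\mathrm{Minset}(t)=\{i\in[k]: s[i]\in F\}$. For $V\subseteq A$, the projection $\mathrm{pr}_V(\mathfrak{A})$ is the $\tau$-structure with domain $V$ obtained as follows: for every $R\in\tau$ and every $s\in R^{\mathfrak{A}}$, remove $s$ from $R$ and add $\mathrm{pr}_I(s)$ to $\mathrm{pr}_I R$, where $I=\{i: s[i]\in V\}$. -}

module Defs where

open import Data.Nat using (ℕ; zero; suc)
open import Data.Bool using (Bool; true; false)
open import Data.Fin using (Fin; zero; suc)
open import Data.Vec using (Vec; []; _∷_; lookup; map; zipWith)
open import Data.Rational using (ℚ; 0ℚ; _≤_; _<_)
open import Data.Product using (Σ; ∃; _×_; _,_; proj₁)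
open import Data.Sum using (_⊎_)
open import Data.Empty using (⊥)
open import Data.Unit using (⊤)
open import Data.List using (List)
open import Data.List.Membership.Propositional renaming (_∈_ to _∈ₗ_)
open import Relation.Nullary using (¬_)
open import Relation.Binary.PropositionalEquality using (_≡_; subst; sym)
open import Function.Bundles using (_⇔_)
open import Data.Fin.Subset as Sub using (Subset; ∁; ⋃; Nonempty)

-- Index subsets I ⊆ [k] (as characteristic vectors) and projections of
-- tuples onto them, keeping the entries in increasing index order.

card : ∀ {k} → Vec Bool k → ℕ
card []          = zero
card (true  ∷ I) = suc (card I)
card (false ∷ I) = card I

projT : ∀ {a} {X : Set a} {k} (I : Vec Bool k) → Vec X k → Vec X (card I)
projT []          []      = []
projT (true  ∷ I) (x ∷ t) = x ∷ projT I t
projT (false ∷ I) (x ∷ t) = projT I t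

data Form : ℕ → Set where
  ff tt   : ∀ {n} → Form n
  _≺_ _≐_ : ∀ {n} → Fin n → Fin n → Form n
  ¬′_     : ∀ {n} → Form n → Form n
  _∧′_ _∨′_ : ∀ {n} → Form n → Form n → Form n
  ∃′ ∀′   : ∀ {n} → Form (suc n) → Form n

extend : ∀ {n} → ℚ → (Fin n → ℚ) → Fin (suc n) → ℚ
extend q ρ zero    = q
extend q ρ (suc i) = ρ i

⟦_⟧ : ∀ {n} → Form n → (Fin n → ℚ) → Set
⟦ ff ⟧      ρ = ⊥
⟦ tt ⟧      ρ = ⊤
⟦ x ≺ y ⟧   ρ = ρ x < ρ y
⟦ x ≐ y ⟧   ρ = ρ x ≡ ρ y
⟦ ¬′ φ ⟧    ρ = ¬ ⟦ φ ⟧ ρ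
⟦ φ ∧′ ψ ⟧  ρ = ⟦ φ ⟧ ρ × ⟦ ψ ⟧ ρ
⟦ φ ∨′ ψ ⟧  ρ = ⟦ φ ⟧ ρ ⊎ ⟦ ψ ⟧ ρ
⟦ ∃′ φ ⟧    ρ = Σ ℚ λ q → ⟦ φ ⟧ (extend q ρ)
⟦ ∀′ φ ⟧    ρ = (q : ℚ) → ⟦ φ ⟧ (extend q ρ)

FODefinable : ∀ {k} → (Vec ℚ k → Set) → Set
FODefinable {k} R = Σ (Form k) λ φ → ∀ t → R t ⇔ ⟦ φ ⟧ (lookup t)

-- Finite relational signatures closed under projections.
-- Symbols are Fin m; pr R I is the symbol pr_I R, of arity |I|.

record Signature : Set where
  field
    m        : ℕ
    arity    : Fin m → ℕ
    pr       : (R : Fin m) → Vec Bool (arity R) → Fin m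
    pr-arity : (R : Fin m) (I : Vec Bool (arity R)) → arity (pr R I) ≡ card I
open Signature public

record Structure (τ : Signature) (D : Set) : Set₁ where
  field
    rel : (R : Fin (m τ)) → Vec D (arity τ R) → Set
open Structure public

Hom : ∀ {τ D E} → Structure τ D → Structure τ E → (D → E) → Set
Hom {τ} 𝔄 𝔅 h = ∀ (R : Fin (m τ)) t → rel 𝔄 R t → rel 𝔅 R (map h t)

HasHom : ∀ {τ D E} → Structure τ D → Structure τ E → Set
HasHom {D = D} {E} 𝔄 𝔅 = Σ (D → E) λ h → Hom 𝔄 𝔅 h

record Temporal (τ : Signature) : Set₁ where
  field
    str       : Structure τ ℚ
    definable : ∀ R → FODefinable (rel str R)
    pr-rel    : ∀ R (I : Vec Bool (arity τ R)) (t : Vec ℚ (arity τ (pr τ R I))) →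
                rel str (pr τ R I) t ⇔
                (Σ (Vec ℚ (arity τ R)) λ u → rel str R u ×
                   subst (Vec ℚ) (pr-arity τ R I) t ≡ projT I u)
open Temporal public

-- The operation pp (any binary operation with the defining property).

IsPP : (ℚ → ℚ → ℚ) → Set
IsPP pp = ∀ a b a′ b′ →
  (pp a b ≤ pp a′ b′) ⇔ ((a ≤ 0ℚ × a ≤ a′) ⊎ (0ℚ < a × 0ℚ < a′ × b ≤ b′))

Preserves₂ : ∀ {τ} → (ℚ → ℚ → ℚ) → Structure τ ℚ → Set
Preserves₂ {τ} f 𝔅 = ∀ (R : Fin (m τ)) t₁ t₂ →
  rel 𝔅 R t₁ → rel 𝔅 R t₂ → rel 𝔅 R (zipWith f t₁ t₂)

Instance : Signature → ℕ → Set₁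
Instance τ n = Structure τ (Fin n)

InMinset : ∀ {k} → Vec ℚ k → Fin k → Set
InMinset t i = ∀ j → lookup t i ≤ lookup t j

IsFree : ∀ {τ n} → Temporal τ → Instance τ n → Subset n → Set
IsFree {τ} 𝔅 𝔄 F =
  Nonempty F ×
  (∀ (R : Fin (m τ)) s → rel 𝔄 R s →
     (∀ i → ¬ (lookup s i Sub.∈ F)) ⊎
     (Σ (Vec ℚ (arity τ R)) λ t → rel (str 𝔅) R t ×
        (∀ i → InMinset t i ⇔ (lookup s i Sub.∈ F))))

UnionOfFree : ∀ {τ n} → Temporal τ → Instance τ n → Subset n → Set
UnionOfFree 𝔅 𝔄 S =
  Σ (List (Subset _)) λ Fs → (∀ F → F ∈ₗ Fs → IsFree 𝔅 𝔄 F) × ⋃ Fs ≡ S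

-- Projection pr_V(𝔄): domain V; each tuple s ∈ R^𝔄 is replaced by
-- pr_I(s) ∈ pr_I R, where I = {i : s[i] ∈ V}.

Elem : ∀ {n} → Subset n → Set
Elem {n} V = Σ (Fin n) λ x → x Sub.∈ V

indexSet : ∀ {n k} → Subset n → Vec (Fin n) k → Vec Bool k
indexSet V s = map (lookup V) s

projStr : ∀ {τ n} → Instance τ n → (V : Subset n) → Structure τ (Elem V)
rel (projStr {τ} {n} 𝔄 V) Q t =
  Σ (Fin (m τ)) λ R → Σ (Vec (Fin n) (arity τ R)) λ s → rel 𝔄 R s ×
  Σ (pr τ R (indexSet V s) ≡ Q) λ e →
    subst (λ P → Vec (Fin n) (arity τ P)) e
      (subst (Vec (Fin n)) (sym (pr-arity τ R (indexSet V s))) (projT (indexSet V s) s))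
    ≡ map proj₁ t

-- Restricting a solution is routine bookkeeping (Projection.restrict-solution).
-- For the converse we use that relations of 𝔅 are first-order definable in
-- (ℚ; <): by a back-and-forth argument (⟦⟧-invariant) membership of a tuple
-- depends only on its order type.  Given a solution g of the projection,
-- extend it by 0; every constraint s ∈ R^𝔄 is then matched on A ∖ S by a tuple
-- of R^𝔅 (Projection.projected-constraint).  Now place F_m, …, F₁ one after the
-- other, each as a single value strictly below everything placed before
-- (Layering.layered).  Each layer is justified by pp-lift: pp combines the
-- tuple witnessing freeness of F (translated so that its minimum is 0) with
-- the tuple obtained so far, producing a tuple whose minimal entries are
-- exactly the entries in F and which keeps the old order elsewhere.  Once all
-- layers are placed every element is covered, and order-invariance turns the
-- final tuples into membership of the layered assignment's images.
module Submission where

open import Defs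
open import Data.Nat using (ℕ)
open import Data.Bool using (Bool; true; false)
open import Data.Fin using (Fin; zero; suc)
open import Data.Fin.Properties using (any?)
open import Data.Fin.Subset using (Subset; ∁; ⋃; _∪_; _∈_; _∉_)
open import Data.Fin.Subset.Properties using (_∈?_; ∉⊥; x∈p∪q⁻; x∈p∪q⁺; x∉p⇒x∈∁p)
open import Data.Vec using (Vec; []; _∷_; lookup; map; zipWith)
open import Data.Vec.Properties using (lookup-map; lookup-zipWith; map-∘; map-cong; ∷-injectiveˡ; ∷-injectiveʳ; []=⇒lookup; lookup⇒[]=)
open import Data.Vec.Properties.WithK using ([]=-irrelevant)
open import Data.List using (List; []; _∷_; filter; allFin)
import Data.List as List
open import Data.List.Relation.Unary.All as All using (All)
open import Data.List.Relation.Unary.All.Properties using (map⁺; map⁻; all-filter)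
open import Data.List.Relation.Unary.Any using (here; there)
open import Data.List.Membership.Propositional using () renaming (_∈_ to _∈ₗ_)
open import Data.List.Membership.Propositional.Properties using (∈-filter⁺; ∈-allFin; ∈-map⁺)
open import Data.Rational using (ℚ; 0ℚ; 1ℚ; _≤_; _<_; _+_; _-_; -_)
open import Data.Rational.Properties using (_≟_; _<?_; ≤-refl; ≤-reflexive; ≤-trans; ≤-antisym; <⇒≤; <-irrefl; <-trans; <-≤-trans; ≤-<-trans; ≰⇒>; <-cmp; <-dense; +-assoc; +-identityʳ; +-inverseˡ; +-inverseʳ; +-monoˡ-≤; +-monoʳ-<; positive⁻¹; ≤-decTotalOrder)
open import Data.Product using (∃-syntax; _×_; _,_; proj₁; proj₂)
open import Data.Sum using (_⊎_; inj₁; inj₂; [_,_]; map₂)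
open import Data.Empty using (⊥-elim)
open import Data.Unit using (tt)
open import Relation.Nullary using (¬_; yes; no)
open import Relation.Nullary.Decidable using (toSum)
open import Relation.Binary.Definitions using (tri<; tri≈; tri>)
open import Relation.Binary.PropositionalEquality using (_≡_; refl; sym; trans; cong; subst; subst₂; module ≡-Reasoning)
open import Relation.Binary.PropositionalEquality.Properties using (subst-application′)
open import Function.Base using (id; _∘_; const)
open import Function.Bundles using (_⇔_; mk⇔; Equivalence)
import Function.Properties.Equivalence as ⇔
open import Relation.Binary.Bundles using (DecTotalOrder)
open import Data.List.Extrema (DecTotalOrder.totalOrder ≤-decTotalOrder) using (min; max; min≤xs; xs≤max; argmax-all; argmin-all)

open Equivalence using (to; from)

<⇒≱ : ∀ {p q} → p < q → ¬ q ≤ p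
<⇒≱ p<q q≤p = <-irrefl refl (<-≤-trans p<q q≤p)

p-q+q≡p : ∀ p q → p - q + q ≡ p
p-q+q≡p p q = begin
  p - q + q     ≡⟨ +-assoc p (- q) q ⟩
  p + (- q + q) ≡⟨ cong (p +_) (+-inverseˡ q) ⟩
  p + 0ℚ        ≡⟨ +-identityʳ p ⟩
  p             ∎
  where open ≡-Reasoning

p<p+1 : ∀ p → p < p + 1ℚ
p<p+1 p = subst (_< p + 1ℚ) (+-identityʳ p) (+-monoʳ-< p (positive⁻¹ 1ℚ))

p-1<p : ∀ p → p - 1ℚ < p
p-1<p p = subst (p - 1ℚ <_) (p-q+q≡p p 1ℚ) (p<p+1 (p - 1ℚ))

shift-≤ : ∀ c {a b} → a ≤ b ⇔ a - c ≤ b - c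
shift-≤ c {a} {b} = mk⇔ (+-monoˡ-≤ (- c))
  (λ le → subst₂ _≤_ (p-q+q≡p a c) (p-q+q≡p b c) (+-monoˡ-≤ c le))

⇔-both : ∀ {P Q : Set} → P → Q → P ⇔ Q
⇔-both p q = mk⇔ (const q) (const p)

⇔-neither : ∀ {P Q : Set} → ¬ P → ¬ Q → P ⇔ Q
⇔-neither ¬p ¬q = mk⇔ (⊥-elim ∘ ¬p) (⊥-elim ∘ ¬q)

≤-cong-⇔ : ∀ {a a′ b b′ : ℚ} → a ≡ a′ → b ≡ b′ → a ≤ b ⇔ a′ ≤ b′
≤-cong-⇔ refl refl = ⇔.refl

-- Density without endpoints, finitary form: any finite cut of ℚ can be filled.
fill-cut : (xs ys : List ℚ) → All (λ x → All (x <_) ys) xs →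
           ∃[ q ] All (_< q) xs × All (q <_) ys
fill-cut xs ys xs<ys = q , All.map (λ x≤a → ≤-<-trans x≤a a<q) (xs≤max lo xs)
                         , All.map (λ b≤y → <-≤-trans q<b b≤y) (min≤xs (a + 1ℚ) ys)
  where
  lo : ℚ
  lo = min 0ℚ ys - 1ℚ
  a : ℚ
  a = max lo xs
  a<ys : All (a <_) ys
  a<ys = All.tabulate λ y∈ys →
    argmax-all id (<-≤-trans (p-1<p _) (All.lookup (min≤xs 0ℚ ys) y∈ys))
                  (All.map (λ x<ys → All.lookup x<ys y∈ys) xs<ys)
  a<b : a < min (a + 1ℚ) ys
  a<b = argmin-all id (p<p+1 a) a<ys
  q : ℚ
  q = proj₁ (<-dense a<b)
  a<q : a < q
  a<q = proj₁ (proj₂ (<-dense a<b))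
  q<b : q < min (a + 1ℚ) ys
  q<b = proj₂ (proj₂ (<-dense a<b))

-- Two assignments have the same order type if they compare all pairs of
-- variables alike.  Formulas over (ℚ; <) cannot tell such assignments apart.
SameOrder : ∀ {n} → (Fin n → ℚ) → (Fin n → ℚ) → Set
SameOrder ρ ρ′ = ∀ i j → ρ i ≤ ρ j ⇔ ρ′ i ≤ ρ′ j

module _ {n : ℕ} {ρ ρ′ : Fin n → ℚ} (same : SameOrder ρ ρ′) where

  SameOrder-sym : SameOrder ρ′ ρ
  SameOrder-sym i j = mk⇔ (from (same i j)) (to (same i j))

  SameOrder-< : ∀ i j → ρ i < ρ j → ρ′ i < ρ′ j
  SameOrder-< i j ρi<ρj = ≰⇒> λ ρ′j≤ρ′i → <⇒≱ ρi<ρj (from (same j i) ρ′j≤ρ′i)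

  SameOrder-≡ : ∀ i j → ρ i ≡ ρ j → ρ′ i ≡ ρ′ j
  SameOrder-≡ i j ρi≡ρj = ≤-antisym (to (same i j) (≤-reflexive ρi≡ρj))
                                   (to (same j i) (≤-reflexive (sym ρi≡ρj)))

RespectsCut : ∀ {n} → ℚ → (Fin n → ℚ) → ℚ → (Fin n → ℚ) → Set
RespectsCut q ρ q′ ρ′ =
  ∀ j → (ρ j < q → ρ′ j < q′) × (ρ j ≡ q → ρ′ j ≡ q′) × (q < ρ j → q′ < ρ′ j)

RespectsCut-≤ : ∀ {n q q′} {ρ ρ′ : Fin n → ℚ} → RespectsCut q ρ q′ ρ′ →
                ∀ j → (ρ j ≤ q ⇔ ρ′ j ≤ q′) × (q ≤ ρ j ⇔ q′ ≤ ρ′ j)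
RespectsCut-≤ {q = q} {ρ = ρ} cut j with <-cmp (ρ j) q | cut j
... | tri< lt _ _ | (below , _ , _) =
  ⇔-both (<⇒≤ lt) (<⇒≤ (below lt)) , ⇔-neither (<⇒≱ lt) (<⇒≱ (below lt))
... | tri≈ _ eq _ | (_ , at , _) =
  ⇔-both (≤-reflexive eq) (≤-reflexive (at eq)) ,
  ⇔-both (≤-reflexive (sym eq)) (≤-reflexive (sym (at eq)))
... | tri> _ _ gt | (_ , _ , above) =
  ⇔-neither (<⇒≱ gt) (<⇒≱ (above gt)) , ⇔-both (<⇒≤ gt) (<⇒≤ (above gt))

SameOrder-extend : ∀ {n q q′} {ρ ρ′ : Fin n → ℚ} → SameOrder ρ ρ′ →
                   RespectsCut q ρ q′ ρ′ → SameOrder (extend q ρ) (extend q′ ρ′)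
SameOrder-extend same cut zero    zero    = ⇔-both ≤-refl ≤-refl
SameOrder-extend same cut zero    (suc j) = proj₂ (RespectsCut-≤ cut j)
SameOrder-extend same cut (suc i) zero    = proj₁ (RespectsCut-≤ cut i)
SameOrder-extend same cut (suc i) (suc j) = same i j

-- The extension step of a back-and-forth argument: every new point q for ρ
-- has a partner q′ for ρ′.  Either q is already a value ρ i (take ρ′ i), or
-- it fills a cut of ρ, and the corresponding cut of ρ′ is filled by fill-cut.
cut-partner : ∀ {n} {ρ ρ′ : Fin n → ℚ} → SameOrder ρ ρ′ →
              ∀ q → ∃[ q′ ] RespectsCut q ρ q′ ρ′
cut-partner {n} {ρ} {ρ′} same q with any? (λ i → ρ i ≟ q)
... | yes (i , ρi≡q) = ρ′ i , subst (λ p → RespectsCut p ρ (ρ′ i) ρ′) ρi≡q at-value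
  where
  at-value : RespectsCut (ρ i) ρ (ρ′ i) ρ′
  at-value j = SameOrder-< same j i , SameOrder-≡ same j i , SameOrder-< same i j
... | no q∉ρ = q′ , λ j → below j , (λ ρj≡q → ⊥-elim (q∉ρ (j , ρj≡q))) , above j
  where
  lower upper : List (Fin n)
  lower = filter (λ i → ρ i <? q) (allFin n)
  upper = filter (λ i → q <? ρ i) (allFin n)
  lower<upper : All (λ x → All (x <_) (List.map ρ′ upper)) (List.map ρ′ lower)
  lower<upper = map⁺ (All.map (λ {i} ρi<q → map⁺ (All.map (λ {j} q<ρj →
                  SameOrder-< same i j (<-trans ρi<q q<ρj))
                  (all-filter (λ i → q <? ρ i) (allFin n))))
                (all-filter (λ i → ρ i <? q) (allFin n)))
  filled : ∃[ q′ ] All (_< q′) (List.map ρ′ lower) × All (q′ <_) (List.map ρ′ upper)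
  filled = fill-cut (List.map ρ′ lower) (List.map ρ′ upper) lower<upper
  q′ : ℚ
  q′ = proj₁ filled
  below : ∀ j → ρ j < q → ρ′ j < q′
  below j ρj<q = All.lookup (map⁻ (proj₁ (proj₂ filled))) (∈-filter⁺ _ (∈-allFin j) ρj<q)
  above : ∀ j → q < ρ j → q′ < ρ′ j
  above j q<ρj = All.lookup (map⁻ (proj₂ (proj₂ filled))) (∈-filter⁺ _ (∈-allFin j) q<ρj)

⟦⟧-invariant : ∀ {n} (φ : Form n) {ρ ρ′ : Fin n → ℚ} → SameOrder ρ ρ′ → ⟦ φ ⟧ ρ → ⟦ φ ⟧ ρ′
⟦⟧-invariant ff       same ()
⟦⟧-invariant tt       same _             = tt
⟦⟧-invariant (x ≺ y)  same x<y           = SameOrder-< same x y x<y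
⟦⟧-invariant (x ≐ y)  same x≡y           = SameOrder-≡ same x y x≡y
⟦⟧-invariant (¬′ φ)   same ¬φ φ′         = ¬φ (⟦⟧-invariant φ (SameOrder-sym same) φ′)
⟦⟧-invariant (φ ∧′ ψ) same (φ₁ , ψ₁)     = ⟦⟧-invariant φ same φ₁ , ⟦⟧-invariant ψ same ψ₁
⟦⟧-invariant (φ ∨′ ψ) same (inj₁ φ₁)     = inj₁ (⟦⟧-invariant φ same φ₁)
⟦⟧-invariant (φ ∨′ ψ) same (inj₂ ψ₁)     = inj₂ (⟦⟧-invariant ψ same ψ₁)
⟦⟧-invariant (∃′ φ)   same (q , φq)      =
  let (q′ , cut) = cut-partner same q
  in q′ , ⟦⟧-invariant φ (SameOrder-extend same cut) φq
⟦⟧-invariant (∀′ φ)   same ∀φ q′         =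
  let (q , cut) = cut-partner (SameOrder-sym same) q′
  in ⟦⟧-invariant φ (SameOrder-sym (SameOrder-extend (SameOrder-sym same) cut)) (∀φ q)

temporal-invariant : ∀ {τ} (𝔅 : Temporal τ) R {v w : Vec ℚ (arity τ R)} →
                     SameOrder (lookup v) (lookup w) → rel (str 𝔅) R v → rel (str 𝔅) R w
temporal-invariant 𝔅 R {v} {w} same v∈R =
  let (φ , defines) = definable 𝔅 R
  in from (defines w) (⟦⟧-invariant φ same (to (defines v) v∈R))

SameOrder-shift : ∀ {k} (t : Vec ℚ k) c → SameOrder (lookup t) (lookup (map (_- c) t))
SameOrder-shift t c i j rewrite lookup-map i (_- c) t | lookup-map j (_- c) t = shift-≤ c

MinsetThen : ∀ {k} → Vec ℚ k → Vec ℚ k → Fin k → Fin k → Set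
MinsetThen t v i j = InMinset t i ⊎ (¬ InMinset t i × ¬ InMinset t j × lookup v i ≤ lookup v j)

MinsetThen-above : ∀ {k} {t v : Vec ℚ k} {i j} → ¬ InMinset t i → InMinset t j →
                   ¬ MinsetThen t v i j
MinsetThen-above ¬min-i _     (inj₁ min-i)            = ¬min-i min-i
MinsetThen-above _      min-j (inj₂ (_ , ¬min-j , _)) = ¬min-j min-j

MinsetThen-rest : ∀ {k} {t v : Vec ℚ k} {i j} → ¬ InMinset t i → ¬ InMinset t j →
                  MinsetThen t v i j ⇔ lookup v i ≤ lookup v j
MinsetThen-rest ¬min-i ¬min-j = mk⇔
  (λ { (inj₁ min-i) → ⊥-elim (¬min-i min-i) ; (inj₂ (_ , _ , ≤v)) → ≤v })
  (λ ≤v → inj₂ (¬min-i , ¬min-j , ≤v))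

-- The key use of pp.  If t, v ∈ R and i₀ ∈ Minset(t), then R contains a tuple
-- w ordered by MinsetThen t v: translate t so that its minimum is 0 and apply
-- pp to the translate and v.
pp-lift : ∀ {τ} (𝔅 : Temporal τ) {pp} → IsPP pp → Preserves₂ pp (str 𝔅) →
  ∀ R {t v : Vec ℚ (arity τ R)} i₀ → InMinset t i₀ → rel (str 𝔅) R t → rel (str 𝔅) R v →
  ∃[ w ] rel (str 𝔅) R w × (∀ i j → lookup w i ≤ lookup w j ⇔ MinsetThen t v i j)
pp-lift {τ} 𝔅 {pp} isPP preserves R {t} {v} i₀ min₀ t∈R v∈R =
  zipWith pp t′ v , preserves R t′ v t′∈R v∈R , compare
  where
  c : ℚ
  c = lookup t i₀
  t′ : Vec ℚ (arity τ R)
  t′ = map (_- c) t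
  t′∈R : rel (str 𝔅) R t′
  t′∈R = temporal-invariant 𝔅 R (SameOrder-shift t c) t∈R
  t′-at : ∀ i → lookup t′ i ≡ lookup t i - c
  t′-at i = lookup-map i (_- c) t

  min⇔≤0 : ∀ i → InMinset t i ⇔ lookup t′ i ≤ 0ℚ
  min⇔≤0 i = mk⇔
    (λ min → subst₂ _≤_ (sym (t′-at i)) (+-inverseʳ c) (to (shift-≤ c) (min i₀)))
    (λ ≤0 j → ≤-trans (from (shift-≤ c) (subst₂ _≤_ (t′-at i) (sym (+-inverseʳ c)) ≤0)) (min₀ j))

  ¬min⇒pos : ∀ {i} → ¬ InMinset t i → 0ℚ < lookup t′ i
  ¬min⇒pos {i} ¬min = ≰⇒> (¬min ∘ from (min⇔≤0 i))

  pos⇒¬min : ∀ {i} → 0ℚ < lookup t′ i → ¬ InMinset t i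
  pos⇒¬min {i} pos min = <⇒≱ pos (to (min⇔≤0 i) min)

  compare : ∀ i j → lookup (zipWith pp t′ v) i ≤ lookup (zipWith pp t′ v) j ⇔ MinsetThen t v i j
  compare i j rewrite lookup-zipWith pp i t′ v | lookup-zipWith pp j t′ v = mk⇔ forth back
    where
    forth : pp (lookup t′ i) (lookup v i) ≤ pp (lookup t′ j) (lookup v j) → MinsetThen t v i j
    forth le with to (isPP _ _ _ _) le
    ... | inj₁ (≤0 , _)          = inj₁ (from (min⇔≤0 i) ≤0)
    ... | inj₂ (pos , pos′ , ≤v) = inj₂ (pos⇒¬min pos , pos⇒¬min pos′ , ≤v)
    back : MinsetThen t v i j → pp (lookup t′ i) (lookup v i) ≤ pp (lookup t′ j) (lookup v j)
    back (inj₁ min) =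
      from (isPP _ _ _ _) (inj₁ (to (min⇔≤0 i) min , to (SameOrder-shift t c i j) (min j)))
    back (inj₂ (¬min , ¬min′ , ≤v)) =
      from (isPP _ _ _ _) (inj₂ (¬min⇒pos ¬min , ¬min⇒pos ¬min′ , ≤v))

projT-map : ∀ {A B : Set} {k} (I : Vec Bool k) (f : A → B) (w : Vec A k) →
            map f (projT I w) ≡ projT I (map f w)
projT-map []          f []      = refl
projT-map (true  ∷ I) f (x ∷ w) = cong (f x ∷_) (projT-map I f w)
projT-map (false ∷ I) f (x ∷ w) = projT-map I f w

projT-agree : ∀ {A : Set} {k} (I : Vec Bool k) {u w : Vec A k} → projT I u ≡ projT I w →
              ∀ i → lookup I i ≡ true → lookup u i ≡ lookup w i
projT-agree (true  ∷ I) {_ ∷ _} {_ ∷ _} eq zero    _ = ∷-injectiveˡ eq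
projT-agree (true  ∷ I) {_ ∷ _} {_ ∷ _} eq (suc i) p = projT-agree I (∷-injectiveʳ eq) i p
projT-agree (false ∷ I) {_ ∷ _} {_ ∷ _} eq (suc i) p = projT-agree I eq i p

subst-map-∘ : ∀ {A B C : Set} {l m} (e : l ≡ m) (π : A → B) (f : B → C) {w : Vec B m}
              (t : Vec A l) → subst (Vec B) (sym e) w ≡ map π t →
              subst (Vec C) e (map (f ∘ π) t) ≡ map f w
subst-map-∘ refl π f t refl = map-∘ f π t

-- Prepend x, tagged with its membership proof, exactly when x ∈ V.  The
-- test's outcome b is an argument so that the length card (b ∷ J) computes.
cons-if-in : ∀ {n k} (V : Subset n) x (b : Bool) → lookup V x ≡ b → (J : Vec Bool k) →
             Vec (Elem V) (card J) → Vec (Elem V) (card (b ∷ J))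
cons-if-in V x true  x∈V J es = (x , lookup⇒[]= x V x∈V) ∷ es
cons-if-in V x false _   J es = es

entriesIn : ∀ {n k} (V : Subset n) (s : Vec (Fin n) k) → Vec (Elem V) (card (indexSet V s))
entriesIn V []      = []
entriesIn V (x ∷ s) = cons-if-in V x (lookup V x) refl (indexSet V s) (entriesIn V s)

entriesIn-proj₁ : ∀ {n k} (V : Subset n) (s : Vec (Fin n) k) →
                  map proj₁ (entriesIn V s) ≡ projT (indexSet V s) s
entriesIn-proj₁ V []      = refl
entriesIn-proj₁ V (x ∷ s) = cons-if-in-proj₁ (lookup V x) refl (entriesIn-proj₁ V s)
  where
  cons-if-in-proj₁ : ∀ b (e : lookup V x ≡ b) {es} → map proj₁ es ≡ projT (indexSet V s) s →
    map proj₁ (cons-if-in V x b e (indexSet V s) es) ≡ projT (b ∷ indexSet V s) (x ∷ s)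
  cons-if-in-proj₁ true  _ es-lists = cong (x ∷_) es-lists
  cons-if-in-proj₁ false _ es-lists = es-lists

-- Extending a partial assignment on V by 0 outside V; it agrees with the
-- original on V because membership proofs are unique.
extendBy0 : ∀ {n} {V : Subset n} → (Elem V → ℚ) → Fin n → ℚ
extendBy0 {V = V} g x with x ∈? V
... | yes x∈V = g (x , x∈V)
... | no  _   = 0ℚ

extendBy0-agrees : ∀ {n} {V : Subset n} (g : Elem V → ℚ) x (x∈V : x ∈ V) →
                   extendBy0 g x ≡ g (x , x∈V)
extendBy0-agrees {V = V} g x x∈V with x ∈? V
... | yes x∈V′ = cong (λ p → g (x , p)) ([]=-irrelevant x∈V′ x∈V)
... | no  x∉V  = ⊥-elim (x∉V x∈V)

module Projection {τ : Signature} (𝔅 : Temporal τ) {n : ℕ} (𝔄 : Instance τ n) (V : Subset n) where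

  restrict-solution : HasHom 𝔄 (str 𝔅) → HasHom (projStr 𝔄 V) (str 𝔅)
  restrict-solution (h , h-hom) = h ∘ proj₁ , hom
    where
    hom : Hom (projStr 𝔄 V) (str 𝔅) (h ∘ proj₁)
    hom _ t (R , s , s∈R , refl , t-lists) =
      from (pr-rel 𝔅 R I (map (h ∘ proj₁) t))
        (map h s , h-hom R s s∈R ,
         trans (subst-map-∘ (pr-arity τ R I) proj₁ h t t-lists) (projT-map I h s))
      where I = indexSet V s

  projected-constraint : (g : Elem V → ℚ) → Hom (projStr 𝔄 V) (str 𝔅) g →
    (f : Fin n → ℚ) → (∀ x (x∈V : x ∈ V) → f x ≡ g (x , x∈V)) →
    ∀ R s → rel 𝔄 R s →
    ∃[ u ] rel (str 𝔅) R u × (∀ i → lookup s i ∈ V → lookup u i ≡ f (lookup s i))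
  projected-constraint g g-hom f f-extends R s s∈R = u , u∈R , agrees
    where
    I : Vec Bool (arity τ R)
    I = indexSet V s
    e : arity τ (pr τ R I) ≡ card I
    e = pr-arity τ R I
    t : Vec (Elem V) (arity τ (pr τ R I))
    t = subst (Vec (Elem V)) (sym e) (entriesIn V s)
    t-lists : subst (Vec (Fin n)) (sym e) (projT I s) ≡ map proj₁ t
    t-lists = trans (cong (subst (Vec (Fin n)) (sym e)) (sym (entriesIn-proj₁ V s)))
                    (subst-application′ (Vec (Elem V)) (λ _ → map proj₁) (sym e))
    witness : ∃[ u ] rel (str 𝔅) R u × subst (Vec ℚ) e (map g t) ≡ projT I u
    witness = to (pr-rel 𝔅 R I (map g t)) (g-hom (pr τ R I) t (R , s , s∈R , refl , t-lists))
    u : Vec ℚ (arity τ R)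
    u = proj₁ witness
    u∈R : rel (str 𝔅) R u
    u∈R = proj₁ (proj₂ witness)
    g≗f∘proj₁ : ∀ x → g x ≡ f (proj₁ x)
    g≗f∘proj₁ (x , x∈V) = sym (f-extends x x∈V)
    same-projection : projT I u ≡ projT I (map f s)
    same-projection = begin
      projT I u                              ≡⟨ sym (proj₂ (proj₂ witness)) ⟩
      subst (Vec ℚ) e (map g t)              ≡⟨ cong (subst (Vec ℚ) e) (map-cong g≗f∘proj₁ t) ⟩
      subst (Vec ℚ) e (map (f ∘ proj₁) t)    ≡⟨ subst-map-∘ e proj₁ f t t-lists ⟩
      map f (projT I s)                      ≡⟨ projT-map I f s ⟩
      projT I (map f s)                      ∎
      where open ≡-Reasoning
    agrees : ∀ i → lookup s i ∈ V → lookup u i ≡ f (lookup s i)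
    agrees i si∈V = trans (projT-agree I same-projection i i∈I) (lookup-map i f s)
      where
      i∈I : lookup I i ≡ true
      i∈I = trans (lookup-map i (lookup V) s) ([]=⇒lookup si∈V)

-- Start from an assignment f that satisfies every
-- constraint of 𝔄 on V (in the sense of projected-constraint) and place the
-- free sets F₁, …, F_m one below the other underneath f: each F_k is sent to
-- a single value below everything placed by F_{k+1}, …, F_m and f.
module Layering {τ : Signature} (𝔅 : Temporal τ) {pp : ℚ → ℚ → ℚ} (isPP : IsPP pp)
  (preserves : Preserves₂ pp (str 𝔅)) {n : ℕ} (𝔄 : Instance τ n) (V : Subset n)
  (f : Fin n → ℚ)
  (on-V : ∀ R s → rel 𝔄 R s →
          ∃[ u ] rel (str 𝔅) R u × (∀ i → lookup s i ∈ V → lookup u i ≡ f (lookup s i)))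
  where

  -- The elements whose relative order is already determined by a list of layers.
  Covered : List (Subset n) → Subset n
  Covered []       = V
  Covered (F ∷ Gs) = F ∪ Covered Gs

  floor : List (Subset n) → ℚ
  floor []       = min 0ℚ (List.map f (allFin n))
  floor (F ∷ Gs) = floor Gs - 1ℚ

  layered : List (Subset n) → Fin n → ℚ
  layered []       x = f x
  layered (F ∷ Gs) x with x ∈? F
  ... | yes _ = floor (F ∷ Gs)
  ... | no  _ = layered Gs x

  floor-≤ : ∀ Gs x → floor Gs ≤ layered Gs x
  floor-≤ []       x = All.lookup (min≤xs 0ℚ _) (∈-map⁺ f (∈-allFin x))
  floor-≤ (F ∷ Gs) x with x ∈? F
  ... | yes _ = ≤-refl
  ... | no  _ = ≤-trans (<⇒≤ (p-1<p _)) (floor-≤ Gs x)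

  module _ {F : Subset n} {Gs : List (Subset n)} where

    layered-in : ∀ {x} → x ∈ F → layered (F ∷ Gs) x ≡ floor (F ∷ Gs)
    layered-in {x} x∈F with x ∈? F
    ... | yes _   = refl
    ... | no  x∉F = ⊥-elim (x∉F x∈F)

    layered-out : ∀ {x} → x ∉ F → layered (F ∷ Gs) x ≡ layered Gs x
    layered-out {x} x∉F with x ∈? F
    ... | yes x∈F = ⊥-elim (x∉F x∈F)
    ... | no  _   = refl

    new-layer-least : ∀ {x} y → x ∈ F → layered (F ∷ Gs) x ≤ layered (F ∷ Gs) y
    new-layer-least y x∈F =
      subst (_≤ layered (F ∷ Gs) y) (sym (layered-in x∈F)) (floor-≤ (F ∷ Gs) y)

    new-layer-below : ∀ {x y} → x ∉ F → y ∈ F → ¬ layered (F ∷ Gs) x ≤ layered (F ∷ Gs) y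
    new-layer-below {x} x∉F y∈F = <⇒≱ (subst₂ _<_ (sym (layered-in y∈F)) (sym (layered-out x∉F))
                                                  (<-≤-trans (p-1<p _) (floor-≤ Gs x)))

    old-layers : ∀ {x y} → x ∉ F → y ∉ F →
                 layered (F ∷ Gs) x ≤ layered (F ∷ Gs) y ⇔ layered Gs x ≤ layered Gs y
    old-layers x∉F y∉F = ≤-cong-⇔ (layered-out x∉F) (layered-out y∉F)

    covered-tail : ∀ {x} → x ∈ Covered (F ∷ Gs) → x ∉ F → x ∈ Covered Gs
    covered-tail {x} x∈ x∉F = [ ⊥-elim ∘ x∉F , id ] (x∈p∪q⁻ F (Covered Gs) x∈)

  Realises : List (Subset n) → ∀ {k} → Vec (Fin n) k → Vec ℚ k → Set
  Realises Gs s v = ∀ i j → lookup s i ∈ Covered Gs → lookup s j ∈ Covered Gs →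
                    lookup v i ≤ lookup v j ⇔ layered Gs (lookup s i) ≤ layered Gs (lookup s j)

  realises-untouched : ∀ {F Gs k} {s : Vec (Fin n) k} {v} → Realises Gs s v →
                       (∀ i → lookup s i ∉ F) → Realises (F ∷ Gs) s v
  realises-untouched {F} {Gs} realises untouched i j si∈ sj∈ =
    ⇔.trans (realises i j (covered-tail {F} {Gs} si∈ (untouched i))
                          (covered-tail {F} {Gs} sj∈ (untouched j)))
            (⇔.sym (old-layers {F} {Gs} (untouched i) (untouched j)))

  realises-new-layer : ∀ {F Gs k} {s : Vec (Fin n) k} {t v w : Vec ℚ k} → Realises Gs s v →
    (∀ i → InMinset t i ⇔ lookup s i ∈ F) →
    (∀ i j → lookup w i ≤ lookup w j ⇔ MinsetThen t v i j) → Realises (F ∷ Gs) s w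
  realises-new-layer {F} {Gs} {s = s} {t} {v} realises minset w-order i j si∈ sj∈
    with toSum (lookup s i ∈? F) | toSum (lookup s j ∈? F)
  ... | inj₁ si∈F | _ =
    ⇔-both (from (w-order i j) (inj₁ (from (minset i) si∈F)))
           (new-layer-least {F} {Gs} (lookup s j) si∈F)
  ... | inj₂ si∉F | inj₁ sj∈F =
    ⇔-neither (MinsetThen-above {t = t} {v} (si∉F ∘ to (minset i)) (from (minset j) sj∈F)
                 ∘ to (w-order i j))
              (new-layer-below {F} {Gs} si∉F sj∈F)
  ... | inj₂ si∉F | inj₂ sj∉F =
    ⇔.trans (w-order i j)
    (⇔.trans (MinsetThen-rest {t = t} {v} (si∉F ∘ to (minset i)) (sj∉F ∘ to (minset j)))
    (⇔.trans (realises i j (covered-tail {F} {Gs} si∈ si∉F) (covered-tail {F} {Gs} sj∈ sj∉F))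
             (⇔.sym (old-layers {F} {Gs} si∉F sj∉F))))

  realised : ∀ Gs → (∀ F → F ∈ₗ Gs → IsFree 𝔅 𝔄 F) →
             ∀ R s → rel 𝔄 R s → ∃[ v ] rel (str 𝔅) R v × Realises Gs s v
  realised [] _ R s s∈R =
    let (u , u∈R , agrees) = on-V R s s∈R
    in u , u∈R , λ i j si∈V sj∈V → ≤-cong-⇔ (agrees i si∈V) (agrees j sj∈V)
  realised (F ∷ Gs) free R s s∈R
    with realised Gs (λ G G∈Gs → free G (there G∈Gs)) R s s∈R | any? (λ i → lookup s i ∈? F)
  ... | v , v∈R , realises | no untouched =
    v , v∈R , realises-untouched {s = s} {v} realises (λ i si∈F → untouched (i , si∈F))
  ... | v , v∈R , realises | yes (i₀ , si₀∈F) with proj₂ (free F (here refl)) R s s∈R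
  ...   | inj₁ untouched = ⊥-elim (untouched i₀ si₀∈F)
  ...   | inj₂ (t , t∈R , minset) =
    let (w , w∈R , w-order) =
          pp-lift 𝔅 isPP preserves R {t} {v} i₀ (from (minset i₀) si₀∈F) t∈R v∈R
    in w , w∈R , realises-new-layer {s = s} {t} {v} {w} realises minset w-order

  covered : ∀ Fs {x} → x ∈ V ⊎ x ∈ ⋃ Fs → x ∈ Covered Fs
  covered []       (inj₁ x∈V)  = x∈V
  covered []       (inj₂ x∈⊥)  = ⊥-elim (∉⊥ x∈⊥)
  covered (F ∷ Fs) (inj₁ x∈V)  = x∈p∪q⁺ (inj₂ (covered Fs (inj₁ x∈V)))
  covered (F ∷ Fs) (inj₂ x∈⋃)  =
    x∈p∪q⁺ (map₂ (covered Fs ∘ inj₂) (x∈p∪q⁻ F (⋃ Fs) x∈⋃))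

  layered-solution : ∀ Fs → (∀ F → F ∈ₗ Fs → IsFree 𝔅 𝔄 F) → (∀ x → x ∈ V ⊎ x ∈ ⋃ Fs) →
                     Hom 𝔄 (str 𝔅) (layered Fs)
  layered-solution Fs free covers R s s∈R =
    let (v , v∈R , realises) = realised Fs free R s s∈R
    in temporal-invariant 𝔅 R (same-order v realises) v∈R
    where
    same-order : ∀ v → Realises Fs s v → SameOrder (lookup v) (lookup (map (layered Fs) s))
    same-order v realises i j =
      ⇔.trans (realises i j (covered Fs (covers _)) (covered Fs (covers _)))
              (≤-cong-⇔ (sym (lookup-map i (layered Fs) s)) (sym (lookup-map j (layered Fs) s)))

complement-covers : ∀ {n} {S : Subset n} (Fs : List (Subset n)) → ⋃ Fs ≡ S →
                    ∀ x → x ∈ ∁ S ⊎ x ∈ ⋃ Fs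
complement-covers {S = S} Fs ⋃Fs≡S x with x ∈? S
... | yes x∈S = inj₂ (subst (x ∈_) (sym ⋃Fs≡S) x∈S)
... | no  x∉S = inj₁ (x∉p⇒x∈∁p x∉S)

proposition3p1 : (τ : Signature) (𝔅 : Temporal τ) (pp : ℚ → ℚ → ℚ) → IsPP pp →
    Preserves₂ pp (str 𝔅) → {n : ℕ} (𝔄 : Instance τ n) (S : Subset n) →
    UnionOfFree 𝔅 𝔄 S →
    HasHom 𝔄 (str 𝔅) ⇔ HasHom (projStr 𝔄 (∁ S)) (str 𝔅)
proposition3p1 τ 𝔅 pp isPP preserves 𝔄 S (Fs , free , ⋃Fs≡S) =
  mk⇔ restrict-solution extend-solution
  where
  open Projection 𝔅 𝔄 (∁ S)
  extend-solution : HasHom (projStr 𝔄 (∁ S)) (str 𝔅) → HasHom 𝔄 (str 𝔅)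
  extend-solution (g , g-hom) =
    layered Fs , layered-solution Fs free (complement-covers Fs ⋃Fs≡S)
    where
    open Layering 𝔅 isPP preserves 𝔄 (∁ S) (extendBy0 g)
                  (projected-constraint g g-hom (extendBy0 g) (extendBy0-agrees g))
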